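{- Let $n$ be a positive integer. The sequence $(d_1,\dots,d_n)$ with $d_i=3$ for all $i\in\{1,\dots,n\}$ is the degree sequence of a triangular multigraph if and only if $n$ is divisible by $4$.
   Context: A multigraph is a finite graph in which multiple edges (and possibly loops) are allowed; the degree of a vertex is the number of incident edges counted with multiplicity. A triangle in a multigraph consists of three distinct vertices which are pairwise adjacent. A multigraph is triangular if every edge is contained in a triangle. A sequence $(d_1,\dots,d_n)$ is the degree sequence of a multigraph if the multigraph has vertices $v_1,\dots,v_n$ with $\deg(v_i)=d_i$ for all $i$. -}

module Defs where

open import Data.Nat using (ℕ; zero; suc; _+_)
open import Data.Fin using (Fin; _≟_)
open import Data.Product using (_×_; _,_; Σ; ∃-syntax; proj₁; proj₂)
open import Data.Sum using (_⊎_)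
open import Data.List using (map; allFin)
open import Data.Nat.ListAction using (sum)
open import Relation.Nullary using (¬_)
open import Relation.Nullary.Decidable using (⌊_⌋)
open import Relation.Binary.PropositionalEquality using (_≡_)
open import Data.Bool using (if_then_else_)

-- A finite multigraph on the vertex set Fin n: a finite number of edges,
-- each edge given by its (unordered) pair of endpoints; parallel edges and
-- loops (both endpoints equal) are allowed.
record Multigraph (n : ℕ) : Set where
  field
    edgeCount : ℕ
    ends      : Fin edgeCount → Fin n × Fin n

open Multigraph public

[_≟_] : ∀ {n} → Fin n → Fin n → ℕ
[ u ≟ v ] = if ⌊ u ≟ v ⌋ then 1 else 0

-- degree: number of incident edges counted with multiplicity
-- (a loop at v contributes 2, one for each of its ends)
degree : ∀ {n} → Multigraph n → Fin n → ℕ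
degree G v = sum (map (λ e → [ proj₁ (ends G e) ≟ v ] + [ proj₂ (ends G e) ≟ v ])
                      (allFin (edgeCount G)))

Joins : ∀ {n} (G : Multigraph n) → Fin (edgeCount G) → Fin n → Fin n → Set
Joins G e u v = (proj₁ (ends G e) ≡ u × proj₂ (ends G e) ≡ v)
              ⊎ (proj₁ (ends G e) ≡ v × proj₂ (ends G e) ≡ u)

Adjacent : ∀ {n} → Multigraph n → Fin n → Fin n → Set
Adjacent G u v = ∃[ e ] Joins G e u v

IsTriangle : ∀ {n} → Multigraph n → Fin n → Fin n → Fin n → Set
IsTriangle G u v w =
  ¬ (u ≡ v) × ¬ (u ≡ w) × ¬ (v ≡ w) ×
  Adjacent G u v × Adjacent G u w × Adjacent G v w

EdgeInTriangle : ∀ {n} (G : Multigraph n) → Fin (edgeCount G) → Set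
EdgeInTriangle G e =
  ∃[ w ] IsTriangle G (proj₁ (ends G e)) (proj₂ (ends G e)) w

Triangular : ∀ {n} → Multigraph n → Set
Triangular G = ∀ e → EdgeInTriangle G e

-- d : Fin n → ℕ is the degree sequence of a multigraph satisfying P
-- (vertex v_i is identified with i : Fin n)
IsDegreeSequenceOf : ∀ {n} → (Multigraph n → Set) → (Fin n → ℕ) → Set
IsDegreeSequenceOf {n} P d = Σ (Multigraph n) λ G → P G × (∀ i → degree G i ≡ d i)

-- A loop lies in no triangle, so a triangular multigraph is loopless, and in a cubic one
-- every vertex lies on exactly three edges. There are no parallel edges either: a
-- double edge v–a forces v and a to have the same third neighbour c, and the third edge at c
-- then leaves {v, a, c} along an edge that lies in no triangle. So every vertex has exactly
-- three neighbours, and chasing triangles shows that adjacent vertices have the same closed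
-- neighbourhood. Hence "equal or adjacent" is an equivalence relation whose classes have four
-- elements, and 4 ∣ n. Conversely, disjoint copies of K₄ form a cubic triangular multigraph.

module Submission where

open import Defs
open import Data.Bool using (true; false)
open import Data.Empty using (⊥)
open import Data.Fin using (Fin; zero; suc; _≟_; _↑ˡ_; _↑ʳ_; splitAt; join)
open import Data.Fin.Patterns using (0F; 1F; 2F; 3F; 4F; 5F)
import Data.Fin.Properties as Fin
open import Data.List using (List; []; _∷_; length; filter; map; allFin; tabulate)
open import Data.List.Membership.Propositional using (_∈_; _∉_; find)
open import Data.List.Membership.Propositional.Properties using (∈-filter⁺; ∈-filter⁻; ∈-allFin)
open import Data.List.Membership.Propositional.Properties.WithK using (unique∧set⇒bag)
open import Data.List.Properties
  using (length-filter; filter-notAll; filter-reject; length-tabulate; map-tabulate; tabulate-cong)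
open import Data.List.Relation.Binary.BagAndSetEquality using (_∼[_]_; set; ∼bag⇒↭)
open import Data.List.Relation.Binary.Permutation.Propositional.Properties using (↭-length)
open import Data.List.Relation.Binary.Subset.Propositional using (_⊆_)
open import Data.List.Relation.Binary.Subset.Propositional.Properties using (∈-∷⁺ʳ)
open import Data.List.Relation.Unary.All as All using (all?; []; _∷_)
open import Data.List.Relation.Unary.All.Properties using (¬All⇒Any¬; ¬Any⇒All¬; All¬⇒¬Any)
open import Data.List.Relation.Unary.AllPairs using ([]; _∷_)
open import Data.List.Relation.Unary.Any using (here; there)
open import Data.List.Relation.Unary.Unique.Propositional using (Unique)
import Data.List.Relation.Unary.Unique.Propositional.Properties as Unique
open import Data.Nat using (ℕ; zero; suc; _+_; _*_; _≤_; _<_; s<s; z<s)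
open import Data.Nat.Divisibility using (_∣_; divides; _∣0; ∣-refl; ∣m∣n⇒∣m+n)
open import Data.Nat.Induction using (<-wellFounded)
open import Data.Nat.ListAction using (sum)
open import Data.Nat.Properties using (≤-trans; ≤-reflexive; <⇒≱; n≮n; +-suc; +-assoc; +-identityʳ)
open import Data.Product using (_×_; _,_; ∃-syntax; proj₁; proj₂)
import Data.Product as ×
open import Data.Sum using (_⊎_; inj₁; inj₂; [_,_]′)
import Data.Sum as Sum
open import Function using (_∘_; id)
open import Function.Bundles using (_⇔_; mk⇔)
open import Induction.WellFounded using (Acc; acc)
open import Level using (Level)
open import Relation.Binary.Core using (Rel)
open import Relation.Binary.Definitions using (DecidableEquality) renaming (Decidable to Decidable₂)
open import Relation.Binary.PropositionalEquality
  using (_≡_; _≢_; refl; sym; trans; cong; cong₂; subst; module ≡-Reasoning)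
open import Relation.Binary.Structures using (IsEquivalence)
open import Relation.Nullary using (¬_; Dec; yes; no; does; contradiction)
open import Relation.Nullary.Decidable using (¬?; _×-dec_; _⊎-dec_; decidable-stable; toWitness)
open import Relation.Unary using (Pred; Decidable)

private
  variable
    a p q ℓ : Level
    A : Set a

-- Duplicate-free lists

Unique-∷⁺ : ∀ {x} {xs : List A} → x ∉ xs → Unique xs → Unique (x ∷ xs)
Unique-∷⁺ {xs = xs} x∉xs !xs = ¬Any⇒All¬ xs x∉xs ∷ !xs

Unique-pair : ∀ {x y : A} → x ≢ y → Unique (x ∷ y ∷ [])
Unique-pair x≢y = (x≢y ∷ []) ∷ [] ∷ []

∈[x,y,z]⇒≡x : ∀ {t x y z : A} → t ∈ x ∷ y ∷ z ∷ [] → t ≢ y → t ≢ z → t ≡ x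
∈[x,y,z]⇒≡x (here t≡x) _ _ = t≡x
∈[x,y,z]⇒≡x (there (here t≡y)) t≢y _ = contradiction t≡y t≢y
∈[x,y,z]⇒≡x (there (there (here t≡z))) _ t≢z = contradiction t≡z t≢z

unique∧set⇒length≡ : ∀ {xs ys : List A} → Unique xs → Unique ys → xs ∼[ set ] ys →
                      length xs ≡ length ys
unique∧set⇒length≡ !xs !ys xs∼ys = ↭-length (∼bag⇒↭ (unique∧set⇒bag !xs !ys xs∼ys))

module _ (_≟ᴬ_ : DecidableEquality A) where
  open import Data.List.Membership.DecPropositional _≟ᴬ_ using (_∈?_)

  -- xs has the same elements as the sublist of ys filtered by membership in xs.
  unique∧⊆⇒length≤ : ∀ {xs ys : List A} → Unique xs → Unique ys → xs ⊆ ys → length xs ≤ length ys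
  unique∧⊆⇒length≤ {xs} {ys} !xs !ys xs⊆ys = ≤-trans
    (≤-reflexive (unique∧set⇒length≡ !xs (Unique.filter⁺ (_∈? xs) {ys} !ys) (mk⇔
      (λ x∈xs → ∈-filter⁺ (_∈? xs) (xs⊆ys x∈xs) x∈xs)
      (λ x∈ys′ → proj₂ (∈-filter⁻ (_∈? xs) {xs = ys} x∈ys′)))))
    (length-filter (_∈? xs) ys)

  unique∧length<⇒∃∉ : ∀ {xs ys : List A} → Unique xs → Unique ys → length ys < length xs →
                      ∃[ x ] x ∈ xs × x ∉ ys
  unique∧length<⇒∃∉ {xs} {ys} !xs !ys ys<xs with all? (_∈? ys) xs
  ... | yes xs⊆ys = contradiction (unique∧⊆⇒length≤ !xs !ys (All.lookup xs⊆ys)) (<⇒≱ ys<xs)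
  ... | no xs⊈ys = find (¬All⇒Any¬ (_∈? ys) xs xs⊈ys)

  unique∧⊆∧length≥⇒⊇ : ∀ {xs ys : List A} → Unique xs → Unique ys → xs ⊆ ys →
                       length ys ≤ length xs → ys ⊆ xs
  unique∧⊆∧length≥⇒⊇ {xs} {ys} !xs !ys xs⊆ys ys≤xs {y} y∈ys with y ∈? xs
  ... | yes y∈xs = y∈xs
  ... | no y∉xs = contradiction
    (≤-trans (unique∧⊆⇒length≤ (Unique-∷⁺ y∉xs !xs) !ys (∈-∷⁺ʳ y∈ys xs⊆ys)) ys≤xs) (n≮n _)

-- Filtering and counting

module _ {P : Pred A p} (P? : Decidable P) where

  sum-map≡length-filter : ∀ {f : A → ℕ} → (∀ {x} → P x → f x ≡ 1) → (∀ {x} → ¬ P x → f x ≡ 0) →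
                          ∀ xs → sum (map f xs) ≡ length (filter P? xs)
  sum-map≡length-filter f≡1 f≡0 [] = refl
  sum-map≡length-filter f≡1 f≡0 (x ∷ xs) with P? x
  ... | yes px = cong₂ _+_ (f≡1 px) (sum-map≡length-filter f≡1 f≡0 xs)
  ... | no ¬px = cong₂ _+_ (f≡0 ¬px) (sum-map≡length-filter f≡1 f≡0 xs)

  length-filter+length-filter-¬ : ∀ xs →
    length (filter P? xs) + length (filter (¬? ∘ P?) xs) ≡ length xs
  length-filter+length-filter-¬ [] = refl
  length-filter+length-filter-¬ (x ∷ xs) with P? x
  ... | yes _ = cong suc (length-filter+length-filter-¬ xs)
  ... | no _ = trans (+-suc _ _) (cong suc (length-filter+length-filter-¬ xs))

  filter-filter-⊆ : ∀ {Q : Pred A q} (Q? : Decidable Q) → (∀ {x} → P x → Q x) →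
                    ∀ xs → filter P? (filter Q? xs) ≡ filter P? xs
  filter-filter-⊆ Q? P⊆Q [] = refl
  filter-filter-⊆ Q? P⊆Q (x ∷ xs) with Q? x
  ... | no ¬qx = trans (filter-filter-⊆ Q? P⊆Q xs) (sym (filter-reject P? (¬qx ∘ P⊆Q)))
  ... | yes _ with does (P? x)
  ...   | true  = cong (x ∷_) (filter-filter-⊆ Q? P⊆Q xs)
  ...   | false = filter-filter-⊆ Q? P⊆Q xs

module _ {_∼_ : Rel A ℓ} (∼-isEquivalence : IsEquivalence _∼_) (_∼?_ : Decidable₂ _∼_) where
  open IsEquivalence ∼-isEquivalence renaming (refl to ∼-refl; sym to ∼-sym; trans to ∼-trans)

  equal-classes⇒∣length : ∀ k xs → (∀ {x} → x ∈ xs → length (filter (x ∼?_) xs) ≡ k) → k ∣ length xs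
  equal-classes⇒∣length k xs = go xs (<-wellFounded (length xs))
    where
    go : ∀ xs → Acc _<_ (length xs) → (∀ {x} → x ∈ xs → length (filter (x ∼?_) xs) ≡ k) →
         k ∣ length xs
    go [] _ _ = k ∣0
    go xs@(x ∷ _) (acc smaller) classes =
      subst (k ∣_) (length-filter+length-filter-¬ (x ∼?_) xs)
        (∣m∣n⇒∣m+n (subst (k ∣_) (sym (classes (here refl))) ∣-refl)
                   (go rest (smaller rest<xs) rest-classes))
      where
      rest : List _
      rest = filter (¬? ∘ (x ∼?_)) xs
      rest<xs : length rest < length xs
      rest<xs = filter-notAll (¬? ∘ (x ∼?_)) xs (here (λ x≁x → x≁x ∼-refl))
      rest-classes : ∀ {y} → y ∈ rest → length (filter (y ∼?_) rest) ≡ k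
      rest-classes {y} y∈rest with y∈xs , x≁y ← ∈-filter⁻ (¬? ∘ (x ∼?_)) y∈rest =
        trans (cong length (filter-filter-⊆ (y ∼?_) (¬? ∘ (x ∼?_))
                              (λ y∼z x∼z → x≁y (∼-trans x∼z (∼-sym y∼z))) xs))
              (classes y∈xs)

-- Incidence and adjacency

module _ {n} {u v : Fin n} where

  [≟]≡1 : u ≡ v → [ u ≟ v ] ≡ 1
  [≟]≡1 u≡v with u ≟ v
  ... | yes _ = refl
  ... | no u≢v = contradiction u≡v u≢v

  [≟]≡0 : u ≢ v → [ u ≟ v ] ≡ 0
  [≟]≡0 u≢v with u ≟ v
  ... | yes u≡v = contradiction u≡v u≢v
  ... | no _ = refl

[≟]-injective : ∀ {m n} {f : Fin m → Fin n} → (∀ {x y} → f x ≡ f y → x ≡ y) →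
                ∀ x y → [ f x ≟ f y ] ≡ [ x ≟ y ]
[≟]-injective f-injective x y with x ≟ y
... | yes refl = [≟]≡1 refl
... | no x≢y = [≟]≡0 (x≢y ∘ f-injective)

module _ {n} (G : Multigraph n) where

  Loopless : Set
  Loopless = ∀ e → proj₁ (ends G e) ≢ proj₂ (ends G e)

  incidence : Fin n → Fin (edgeCount G) → ℕ
  incidence v e = [ proj₁ (ends G e) ≟ v ] + [ proj₂ (ends G e) ≟ v ]

  Incident : Fin n → Fin (edgeCount G) → Set
  Incident v e = proj₁ (ends G e) ≡ v ⊎ proj₂ (ends G e) ≡ v

  incident? : ∀ v → Decidable (Incident v)
  incident? v e = (proj₁ (ends G e) ≟ v) ⊎-dec (proj₂ (ends G e) ≟ v)

  edgesAt : Fin n → List (Fin (edgeCount G))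
  edgesAt v = filter (incident? v) (allFin (edgeCount G))

  adjacent? : ∀ u v → Dec (Adjacent G u v)
  adjacent? u v = Fin.any? λ e →
    ((proj₁ (ends G e) ≟ u) ×-dec (proj₂ (ends G e) ≟ v)) ⊎-dec
    ((proj₁ (ends G e) ≟ v) ×-dec (proj₂ (ends G e) ≟ u))

  isTriangle? : ∀ u v w → Dec (IsTriangle G u v w)
  isTriangle? u v w = ¬? (u ≟ v) ×-dec ¬? (u ≟ w) ×-dec ¬? (v ≟ w) ×-dec
                      adjacent? u v ×-dec adjacent? u w ×-dec adjacent? v w

  triangular? : Dec (Triangular G)
  triangular? = Fin.all? λ e → Fin.any? (isTriangle? (proj₁ (ends G e)) (proj₂ (ends G e)))

  SameOrAdjacent : Fin n → Fin n → Set
  SameOrAdjacent u v = u ≡ v ⊎ Adjacent G u v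

  sameOrAdjacent? : ∀ u v → Dec (SameOrAdjacent u v)
  sameOrAdjacent? u v = (u ≟ v) ⊎-dec adjacent? u v

  closedNeighbourhood : Fin n → List (Fin n)
  closedNeighbourhood v = filter (sameOrAdjacent? v) (allFin n)

  degree≡sum-incidence : ∀ v → degree G v ≡ sum (tabulate (incidence v))
  degree≡sum-incidence v = cong sum (map-tabulate {n = edgeCount G} id (incidence v))

  degree≡length-edgesAt : Loopless → ∀ v → degree G v ≡ length (edgesAt v)
  degree≡length-edgesAt loopless v =
    sum-map≡length-filter (incident? v) once never (allFin (edgeCount G))
    where
    once : ∀ {e} → Incident v e → incidence v e ≡ 1
    once {e} (inj₁ p₁≡v) =
      cong₂ _+_ ([≟]≡1 p₁≡v) ([≟]≡0 (λ p₂≡v → loopless e (trans p₁≡v (sym p₂≡v))))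
    once {e} (inj₂ p₂≡v) =
      cong₂ _+_ ([≟]≡0 (λ p₁≡v → loopless e (trans p₁≡v (sym p₂≡v)))) ([≟]≡1 p₂≡v)
    never : ∀ {e} → ¬ Incident v e → incidence v e ≡ 0
    never ¬incident = cong₂ _+_ ([≟]≡0 (¬incident ∘ inj₁)) ([≟]≡0 (¬incident ∘ inj₂))

module Adjacency {n} (G : Multigraph n) where

  Joins-sym : ∀ {e u v} → Joins G e u v → Joins G e v u
  Joins-sym (inj₁ ends≡) = inj₂ ends≡
  Joins-sym (inj₂ ends≡) = inj₁ ends≡

  Joins-functional : ∀ {e v x y} → Joins G e v x → Joins G e v y → x ≡ y
  Joins-functional (inj₁ (refl , refl)) (inj₁ (_ , p₂≡y)) = p₂≡y
  Joins-functional (inj₁ (refl , refl)) (inj₂ (p₁≡y , p₂≡v)) = trans p₂≡v p₁≡y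
  Joins-functional (inj₂ (refl , refl)) (inj₁ (p₁≡v , p₂≡y)) = trans p₁≡v p₂≡y
  Joins-functional (inj₂ (refl , refl)) (inj₂ (p₁≡y , _)) = p₁≡y

  Joins⇒∈edgesAt : ∀ {e v x} → Joins G e v x → e ∈ edgesAt G v
  Joins⇒∈edgesAt {e} {v} j = ∈-filter⁺ (incident? G v) (∈-allFin e) (incident j)
    where
    incident : ∀ {e v x} → Joins G e v x → Incident G v e
    incident (inj₁ (p₁≡v , _)) = inj₁ p₁≡v
    incident (inj₂ (_ , p₂≡v)) = inj₂ p₂≡v

  Incident⇒Joins : ∀ {e v} → Incident G v e → ∃[ x ] Joins G e v x
  Incident⇒Joins (inj₁ p₁≡v) = _ , inj₁ (p₁≡v , refl)
  Incident⇒Joins (inj₂ p₂≡v) = _ , inj₂ (refl , p₂≡v)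

  Joins⇒≢ : Loopless G → ∀ {e v x} → Joins G e v x → v ≢ x
  Joins⇒≢ loopless {e} (inj₁ (refl , refl)) = loopless e
  Joins⇒≢ loopless {e} (inj₂ (refl , refl)) = loopless e ∘ sym

  distinct-ends⇒distinct-edges : ∀ {e e′ v x y} → Joins G e v x → Joins G e′ v y → x ≢ y → e ≢ e′
  distinct-ends⇒distinct-edges j j′ x≢y refl = x≢y (Joins-functional j j′)

  Adjacent-sym : ∀ {u v} → Adjacent G u v → Adjacent G v u
  Adjacent-sym (e , j) = e , Joins-sym j

  Adjacent⇒≢ : Loopless G → ∀ {u v} → Adjacent G u v → u ≢ v
  Adjacent⇒≢ loopless (_ , j) = Joins⇒≢ loopless j

  triangular⇒loopless : Triangular G → Loopless G
  triangular⇒loopless triangular e = proj₁ (proj₂ (triangular e))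

  common-neighbour : Triangular G → ∀ {u x} → Adjacent G u x →
                     ∃[ w ] u ≢ w × x ≢ w × Adjacent G u w × Adjacent G x w
  common-neighbour triangular (e , inj₁ (refl , refl))
    with w , _ , u≢w , x≢w , _ , u~w , x~w ← triangular e = w , u≢w , x≢w , u~w , x~w
  common-neighbour triangular (e , inj₂ (refl , refl))
    with w , _ , x≢w , u≢w , _ , x~w , u~w ← triangular e = w , u≢w , x≢w , u~w , x~w

-- Cubic triangular multigraphs

module CubicTriangular {n} (G : Multigraph n) (triangular : Triangular G)
                       (cubic : ∀ v → degree G v ≡ 3) where

  open Adjacency G

  loopless : Loopless G
  loopless = triangular⇒loopless triangular

  edgesAt-unique : ∀ v → Unique (edgesAt G v)
  edgesAt-unique v = Unique.filter⁺ (incident? G v) {allFin _} (Unique.allFin⁺ _)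

  length-edgesAt : ∀ v → length (edgesAt G v) ≡ 3
  length-edgesAt v = trans (sym (degree≡length-edgesAt G loopless v)) (cubic v)

  another-edge : ∀ v {es : List (Fin (edgeCount G))} → Unique es → length es < 3 →
                 ∃[ e ] e ∉ es × ∃[ x ] Joins G e v x
  another-edge v !es es<3
    with e , e∈edgesAt , e∉es ← unique∧length<⇒∃∉ _≟_ (edgesAt-unique v) !es
                                  (subst (_ <_) (sym (length-edgesAt v)) es<3)
    = e , e∉es , Incident⇒Joins (proj₂ (∈-filter⁻ (incident? G v) {xs = allFin _} e∈edgesAt))

  edges-among-three : ∀ {v e₁ e₂ e₃ x₁ x₂ x₃} → Unique (e₁ ∷ e₂ ∷ e₃ ∷ []) →
                      Joins G e₁ v x₁ → Joins G e₂ v x₂ → Joins G e₃ v x₃ →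
                      ∀ {e x} → Joins G e v x → e ∈ e₁ ∷ e₂ ∷ e₃ ∷ []
  edges-among-three {v} !es j₁ j₂ j₃ j =
    unique∧⊆∧length≥⇒⊇ _≟_ !es (edgesAt-unique v)
      (∈-∷⁺ʳ (Joins⇒∈edgesAt j₁) (∈-∷⁺ʳ (Joins⇒∈edgesAt j₂) (∈-∷⁺ʳ (Joins⇒∈edgesAt j₃) λ ())))
      (≤-reflexive (length-edgesAt v))
      (Joins⇒∈edgesAt j)

  neighbours-among-three : ∀ {v e₁ e₂ e₃ x₁ x₂ x₃} → Unique (e₁ ∷ e₂ ∷ e₃ ∷ []) →
                           Joins G e₁ v x₁ → Joins G e₂ v x₂ → Joins G e₃ v x₃ →
                           ∀ {x} → Adjacent G v x → x ∈ x₁ ∷ x₂ ∷ x₃ ∷ []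
  neighbours-among-three !es j₁ j₂ j₃ (e , j) with edges-among-three !es j₁ j₂ j₃ j
  ... | here refl = here (Joins-functional j j₁)
  ... | there (here refl) = there (here (Joins-functional j j₂))
  ... | there (there (here refl)) = there (there (here (Joins-functional j j₃)))

  double-edge : ∀ {v a e₁ e₂} → e₁ ≢ e₂ → Joins G e₁ v a → Joins G e₂ v a →
                ∃[ e₃ ] ∃[ c ] Joins G e₃ v c × Unique (e₃ ∷ e₁ ∷ e₂ ∷ []) × a ≢ c × Adjacent G a c
  double-edge {v} e₁≢e₂ j₁ j₂
    with e₃ , e₃∉ , c , j₃ ← another-edge v (Unique-pair e₁≢e₂) (s<s (s<s z<s))
    with !v ← Unique-∷⁺ e₃∉ (Unique-pair e₁≢e₂)
    with w , _ , a≢w , v~w , a~w ← common-neighbour triangular (_ , j₁)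
    with neighbours-among-three !v j₃ j₁ j₂ v~w
  ... | here refl = e₃ , w , j₃ , !v , a≢w , a~w
  ... | there (here refl) = contradiction refl a≢w
  ... | there (there (here refl)) = contradiction refl a≢w

  edge-to-third-neighbour : ∀ {v a c e₁ e₂ e₃} → Unique (e₃ ∷ e₁ ∷ e₂ ∷ []) →
                            Joins G e₃ v c → Joins G e₁ v a → Joins G e₂ v a → a ≢ c →
                            ∀ {e} → Joins G e v c → e ≡ e₃
  edge-to-third-neighbour !v j₃ j₁ j₂ a≢c j with edges-among-three !v j₃ j₁ j₂ j
  ... | here e≡e₃ = e≡e₃
  ... | there (here refl) = contradiction (Joins-functional j₁ j) a≢c
  ... | there (there (here refl)) = contradiction (Joins-functional j₂ j) a≢c

  double-edge-absurd : ∀ {v a c e₁ e₂ e₃ e₄} → Joins G e₁ v a → Joins G e₂ v a → a ≢ c →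
                       Joins G e₃ v c → Unique (e₃ ∷ e₁ ∷ e₂ ∷ []) →
                       Joins G e₄ a c → Unique (e₄ ∷ e₁ ∷ e₂ ∷ []) → ⊥
  double-edge-absurd {v} {a} {c} {e₃ = e₃} {e₄} j₁ j₂ a≢c j₃ !v j₄ !a =
    third-edge-at-c-absurd (another-edge c !c (s<s (s<s z<s)))
    where
    !c : Unique (e₃ ∷ e₄ ∷ [])
    !c = Unique-pair
      (distinct-ends⇒distinct-edges (Joins-sym j₃) (Joins-sym j₄) (Joins⇒≢ loopless j₁))
    third-edge-at-c-absurd : (∃[ e₅ ] e₅ ∉ e₃ ∷ e₄ ∷ [] × ∃[ y ] Joins G e₅ c y) → ⊥
    third-edge-at-c-absurd (e₅ , e₅∉ , y , j₅) =
      common-neighbour-absurd (common-neighbour triangular (_ , j₅))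
      where
      y≢c : y ≢ c
      y≢c = Joins⇒≢ loopless (Joins-sym j₅)
      y≢v : y ≢ v
      y≢v refl = e₅∉ (here (edge-to-third-neighbour !v j₃ j₁ j₂ a≢c (Joins-sym j₅)))
      y≢a : y ≢ a
      y≢a refl = e₅∉ (there (here (edge-to-third-neighbour !a j₄ (Joins-sym j₁) (Joins-sym j₂)
                                     (Joins⇒≢ loopless j₃) (Joins-sym j₅))))
      common-neighbour-absurd : (∃[ z ] c ≢ z × y ≢ z × Adjacent G c z × Adjacent G y z) → ⊥
      common-neighbour-absurd (z , _ , y≢z , c~z , y~z)
        with neighbours-among-three (Unique-∷⁺ e₅∉ !c) j₅ (Joins-sym j₃) (Joins-sym j₄) c~z
      ... | here refl = y≢z refl
      ... | there (here refl) =
        All¬⇒¬Any (y≢c ∷ y≢a ∷ y≢a ∷ []) (neighbours-among-three !v j₃ j₁ j₂ (Adjacent-sym y~z))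
      ... | there (there (here refl)) =
        All¬⇒¬Any (y≢c ∷ y≢v ∷ y≢v ∷ [])
                  (neighbours-among-three !a j₄ (Joins-sym j₁) (Joins-sym j₂) (Adjacent-sym y~z))

  parallel-edges-absurd : ∀ {v a e₁ e₂} → e₁ ≢ e₂ → Joins G e₁ v a → Joins G e₂ v a → ⊥
  parallel-edges-absurd e₁≢e₂ j₁ j₂
    with e₃ , c , j₃ , !v , a≢c , a~c ← double-edge e₁≢e₂ j₁ j₂
    with e₄ , _ , j₄ , !a , _ , _ ← double-edge e₁≢e₂ (Joins-sym j₁) (Joins-sym j₂)
    with neighbours-among-three !a j₄ (Joins-sym j₁) (Joins-sym j₂) a~c
  ... | here refl = double-edge-absurd j₁ j₂ a≢c j₃ !v j₄ !a
  ... | there (here c≡v) = contradiction (sym c≡v) (Joins⇒≢ loopless j₃)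
  ... | there (there (here c≡v)) = contradiction (sym c≡v) (Joins⇒≢ loopless j₃)

  parallel-edges-equal : ∀ {v a e₁ e₂} → Joins G e₁ v a → Joins G e₂ v a → e₁ ≡ e₂
  parallel-edges-equal {e₁ = e₁} {e₂} j₁ j₂ =
    decidable-stable (e₁ ≟ e₂) (λ e₁≢e₂ → parallel-edges-absurd e₁≢e₂ j₁ j₂)

  some-neighbour : ∀ v → ∃[ x ] Adjacent G v x
  some-neighbour v with e , _ , x , j ← another-edge v [] z<s = x , e , j

  another-neighbour : ∀ {v x} → Adjacent G v x → ∃[ y ] Adjacent G v y × x ≢ y
  another-neighbour {v} (e , j) with e′ , e′∉ , y , j′ ← another-edge v ([] ∷ []) (s<s z<s) =
    y , (e′ , j′) , λ { refl → e′∉ (here (parallel-edges-equal j′ j)) }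

  third-neighbour : ∀ {v x y} → Adjacent G v x → Adjacent G v y → x ≢ y →
                    ∃[ z ] Adjacent G v z × x ≢ z × y ≢ z ×
                           (∀ {t} → Adjacent G v t → t ≢ x → t ≢ y → t ≡ z)
  third-neighbour {v} (e , j) (e′ , j′) x≢y
    with !ee′ ← Unique-pair (distinct-ends⇒distinct-edges j j′ x≢y)
    with e″ , e″∉ , z , j″ ← another-edge v !ee′ (s<s (s<s z<s))
    = z , (e″ , j″)
      , (λ { refl → e″∉ (here (parallel-edges-equal j″ j)) })
      , (λ { refl → e″∉ (there (here (parallel-edges-equal j″ j′))) })
      , λ v~t → ∈[x,y,z]⇒≡x (neighbours-among-three (Unique-∷⁺ e″∉ !ee′) j″ j j′ v~t)

  only-one-more-neighbour : ∀ {v x y p q} → Adjacent G v x → Adjacent G v y → x ≢ y →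
                            Adjacent G v p → p ≢ x → p ≢ y →
                            Adjacent G v q → q ≢ x → q ≢ y → p ≡ q
  only-one-more-neighbour v~x v~y x≢y v~p p≢x p≢y v~q q≢x q≢y
    with _ , _ , _ , _ , only-z ← third-neighbour v~x v~y x≢y
    = trans (only-z v~p p≢x p≢y) (sym (only-z v~q q≢x q≢y))

  adjacent-to-one-of : ∀ {u w z p} → Adjacent G u p →
                       (∀ {t} → Adjacent G u t → t ≢ w → t ≢ z → t ≡ p) →
                       Adjacent G p w ⊎ Adjacent G p z
  adjacent-to-one-of {w = w} {z} u~p only-p
    with r , _ , p≢r , u~r , p~r ← common-neighbour triangular u~p
    with r ≟ w | r ≟ z
  ... | yes refl | _ = inj₁ p~r
  ... | no _ | yes refl = inj₂ p~r
  ... | no r≢w | no r≢z = contradiction (sym (only-p u~r r≢w r≢z)) p≢r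

  -- z is a common neighbour of u and w. If x is not adjacent to w, its triangle with u makes it
  -- adjacent to z; the triangle on w and its third neighbour q makes q adjacent to u or to z, and
  -- in both cases the neighbourhood of u or of z only has room for q = x.
  neighbourhood-closed : ∀ {u w x} → Adjacent G u w → Adjacent G u x → w ≢ x → Adjacent G w x
  neighbourhood-closed {u} {w} {x} u~w u~x w≢x
    with z , u≢z , w≢z , u~z , w~z ← common-neighbour triangular u~w
    with x ≟ z
  ... | yes refl = w~z
  ... | no x≢z
    with p , _ , _ , _ , only-p ← third-neighbour u~w u~z w≢z
    with adjacent-to-one-of u~x (λ u~t t≢w t≢z →
           trans (only-p u~t t≢w t≢z) (sym (only-p u~x (w≢x ∘ sym) x≢z)))
  ... | inj₁ x~w = Adjacent-sym x~w
  ... | inj₂ x~z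
    with q , w~q , u≢q , z≢q , only-q ← third-neighbour (Adjacent-sym u~w) w~z u≢z
    with adjacent-to-one-of w~q only-q
  ... | inj₁ q~u = subst (Adjacent G w) q≡x w~q
    where
    q≡x : q ≡ x
    q≡x = trans (only-p (Adjacent-sym q~u) (Adjacent⇒≢ loopless w~q ∘ sym) (z≢q ∘ sym))
                (sym (only-p u~x (w≢x ∘ sym) x≢z))
  ... | inj₂ q~z = subst (Adjacent G w) q≡x w~q
    where
    q≡x : q ≡ x
    q≡x = only-one-more-neighbour (Adjacent-sym u~z) (Adjacent-sym w~z) (Adjacent⇒≢ loopless u~w)
            (Adjacent-sym q~z) (u≢q ∘ sym) (Adjacent⇒≢ loopless w~q ∘ sym)
            (Adjacent-sym x~z) (Adjacent⇒≢ loopless u~x ∘ sym) (w≢x ∘ sym)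

  SameOrAdjacent-trans : ∀ {u v w} → SameOrAdjacent G u v → SameOrAdjacent G v w →
                         SameOrAdjacent G u w
  SameOrAdjacent-trans (inj₁ refl) v≈w = v≈w
  SameOrAdjacent-trans u≈v (inj₁ refl) = u≈v
  SameOrAdjacent-trans {u} {v} {w} (inj₂ u~v) (inj₂ v~w) with u ≟ w
  ... | yes u≡w = inj₁ u≡w
  ... | no u≢w = inj₂ (neighbourhood-closed (Adjacent-sym u~v) v~w u≢w)

  SameOrAdjacent-isEquivalence : IsEquivalence (SameOrAdjacent G)
  SameOrAdjacent-isEquivalence = record
    { refl = inj₁ refl
    ; sym = λ { (inj₁ u≡v) → inj₁ (sym u≡v) ; (inj₂ u~v) → inj₂ (Adjacent-sym u~v) }
    ; trans = SameOrAdjacent-trans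
    }

  length-closedNeighbourhood : ∀ v → length (closedNeighbourhood G v) ≡ 4
  length-closedNeighbourhood v
    with a , v~a ← some-neighbour v
    with b , v~b , a≢b ← another-neighbour v~a
    with c , v~c , a≢c , b≢c , only-c ← third-neighbour v~a v~b a≢b
    = unique∧set⇒length≡ (Unique.filter⁺ (sameOrAdjacent? G v) {allFin n} (Unique.allFin⁺ n))
                          !vabc (mk⇔ to from)
    where
    !vabc : Unique (v ∷ a ∷ b ∷ c ∷ [])
    !vabc = (Adjacent⇒≢ loopless v~a ∷ Adjacent⇒≢ loopless v~b ∷ Adjacent⇒≢ loopless v~c ∷ [])
          ∷ (a≢b ∷ a≢c ∷ []) ∷ (b≢c ∷ []) ∷ [] ∷ []
    to : ∀ {t} → t ∈ closedNeighbourhood G v → t ∈ v ∷ a ∷ b ∷ c ∷ []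
    to t∈ with proj₂ (∈-filter⁻ (sameOrAdjacent? G v) {xs = allFin n} t∈)
    ... | inj₁ refl = here refl
    ... | inj₂ v~t with _ ≟ a | _ ≟ b
    ...   | yes t≡a | _ = there (here t≡a)
    ...   | no _ | yes t≡b = there (there (here t≡b))
    ...   | no t≢a | no t≢b = there (there (there (here (only-c v~t t≢a t≢b))))
    sameOrAdjacent : ∀ {t} → t ∈ v ∷ a ∷ b ∷ c ∷ [] → SameOrAdjacent G v t
    sameOrAdjacent (here refl) = inj₁ refl
    sameOrAdjacent (there (here refl)) = inj₂ v~a
    sameOrAdjacent (there (there (here refl))) = inj₂ v~b
    sameOrAdjacent (there (there (there (here refl)))) = inj₂ v~c
    from : ∀ {t} → t ∈ v ∷ a ∷ b ∷ c ∷ [] → t ∈ closedNeighbourhood G v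
    from t∈ = ∈-filter⁺ (sameOrAdjacent? G v) (∈-allFin _) (sameOrAdjacent t∈)

  4∣n : 4 ∣ n
  4∣n = subst (4 ∣_) (length-tabulate id)
    (equal-classes⇒∣length SameOrAdjacent-isEquivalence (sameOrAdjacent? G) 4 (allFin n)
      (λ {v} _ → length-closedNeighbourhood v))

-- Disjoint unions

sum-tabulate-+ : ∀ m {n} (f : Fin (m + n) → ℕ) →
                 sum (tabulate f) ≡ sum (tabulate (f ∘ (_↑ˡ n))) + sum (tabulate (f ∘ (m ↑ʳ_)))
sum-tabulate-+ zero f = refl
sum-tabulate-+ (suc m) f =
  trans (cong (f zero +_) (sum-tabulate-+ m (f ∘ suc))) (sym (+-assoc (f zero) _ _))

sum-tabulate-zero : ∀ {m} {f : Fin m → ℕ} → (∀ i → f i ≡ 0) → sum (tabulate f) ≡ 0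
sum-tabulate-zero {zero} f≡0 = refl
sum-tabulate-zero {suc m} f≡0 = cong₂ _+_ (f≡0 zero) (sum-tabulate-zero (f≡0 ∘ suc))

↑ˡ≢↑ʳ : ∀ {m n} (x : Fin m) (y : Fin n) → x ↑ˡ n ≢ m ↑ʳ y
↑ˡ≢↑ʳ zero y ()
↑ˡ≢↑ʳ (suc x) y eq = ↑ˡ≢↑ʳ x y (Fin.suc-injective eq)

↑ˡ-↑ʳ-elim : ∀ {m n} {P : Fin (m + n) → Set p} → (∀ i → P (i ↑ˡ n)) → (∀ j → P (m ↑ʳ j)) →
             ∀ k → P k
↑ˡ-↑ʳ-elim {m = m} {n} {P} left right k =
  subst P (Fin.join-splitAt m n k) (Sum.[_,_] {C = P ∘ join m n} left right (splitAt m k))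

module _ {n k} {G : Multigraph n} {H : Multigraph k} (f : Fin n → Fin k)
         {e e′} (ends≡ : ends H e′ ≡ ×.map f f (ends G e)) where

  Joins-map : ∀ {u v} → Joins G e u v → Joins H e′ (f u) (f v)
  Joins-map j rewrite ends≡ = Sum.map (×.map (cong f) (cong f)) (×.map (cong f) (cong f)) j

  incidence-map : (∀ {x y} → f x ≡ f y → x ≡ y) → ∀ v → incidence H (f v) e′ ≡ incidence G v e
  incidence-map f-injective v rewrite ends≡ =
    cong₂ _+_ ([≟]-injective f-injective (proj₁ (ends G e)) v)
              ([≟]-injective f-injective (proj₂ (ends G e)) v)

  incidence-outside-image : ∀ {w} → (∀ x → f x ≢ w) → incidence H w e′ ≡ 0
  incidence-outside-image f≢w rewrite ends≡ =
    cong₂ _+_ ([≟]≡0 (f≢w (proj₁ (ends G e)))) ([≟]≡0 (f≢w (proj₂ (ends G e))))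

module _ {n k} {G : Multigraph n} {H : Multigraph k} (f : Fin n → Fin k)
         (f-injective : ∀ {x y} → f x ≡ f y → x ≡ y)
         (f-adjacent : ∀ {u v} → Adjacent G u v → Adjacent H (f u) (f v)) where

  IsTriangle-map : ∀ {u v w} → IsTriangle G u v w → IsTriangle H (f u) (f v) (f w)
  IsTriangle-map (u≢v , u≢w , v≢w , u~v , u~w , v~w) =
    u≢v ∘ f-injective , u≢w ∘ f-injective , v≢w ∘ f-injective ,
    f-adjacent u~v , f-adjacent u~w , f-adjacent v~w

  EdgeInTriangle-map : ∀ {e e′} → ends H e′ ≡ ×.map f f (ends G e) →
                       EdgeInTriangle G e → EdgeInTriangle H e′
  EdgeInTriangle-map ends≡ (w , triangle) rewrite ends≡ = f w , IsTriangle-map triangle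

_⊕_ : ∀ {m n} → Multigraph m → Multigraph n → Multigraph (m + n)
_⊕_ {m} {n} G H = record
  { edgeCount = edgeCount G + edgeCount H
  ; ends = [ ×.map (_↑ˡ n) (_↑ˡ n) ∘ ends G , ×.map (m ↑ʳ_) (m ↑ʳ_) ∘ ends H ]′
           ∘ splitAt (edgeCount G)
  }

module _ {m n} (G : Multigraph m) (H : Multigraph n) where
  open ≡-Reasoning

  ends-⊕-↑ˡ : ∀ e → ends (G ⊕ H) (e ↑ˡ edgeCount H) ≡ ×.map (_↑ˡ n) (_↑ˡ n) (ends G e)
  ends-⊕-↑ˡ e rewrite Fin.splitAt-↑ˡ (edgeCount G) e (edgeCount H) = refl

  ends-⊕-↑ʳ : ∀ e → ends (G ⊕ H) (edgeCount G ↑ʳ e) ≡ ×.map (m ↑ʳ_) (m ↑ʳ_) (ends H e)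
  ends-⊕-↑ʳ e rewrite Fin.splitAt-↑ʳ (edgeCount G) (edgeCount H) e = refl

  Adjacent-⊕-↑ˡ : ∀ {u v} → Adjacent G u v → Adjacent (G ⊕ H) (u ↑ˡ n) (v ↑ˡ n)
  Adjacent-⊕-↑ˡ (e , j) = e ↑ˡ edgeCount H , Joins-map {G = G} {H = G ⊕ H} (_↑ˡ n) (ends-⊕-↑ˡ e) j

  Adjacent-⊕-↑ʳ : ∀ {u v} → Adjacent H u v → Adjacent (G ⊕ H) (m ↑ʳ u) (m ↑ʳ v)
  Adjacent-⊕-↑ʳ (e , j) = edgeCount G ↑ʳ e , Joins-map {G = H} {H = G ⊕ H} (m ↑ʳ_) (ends-⊕-↑ʳ e) j

  ⊕-triangular : Triangular G → Triangular H → Triangular (G ⊕ H)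
  ⊕-triangular G-triangular H-triangular = ↑ˡ-↑ʳ-elim
    (λ e → EdgeInTriangle-map (_↑ˡ n) (Fin.↑ˡ-injective n _ _) Adjacent-⊕-↑ˡ (ends-⊕-↑ˡ e)
                              (G-triangular e))
    (λ e → EdgeInTriangle-map (m ↑ʳ_) (Fin.↑ʳ-injective m _ _) Adjacent-⊕-↑ʳ (ends-⊕-↑ʳ e)
                              (H-triangular e))

  degree-⊕ : ∀ w → degree (G ⊕ H) w ≡ sum (tabulate (λ e → incidence (G ⊕ H) w (e ↑ˡ edgeCount H)))
                                     + sum (tabulate (λ e → incidence (G ⊕ H) w (edgeCount G ↑ʳ e)))
  degree-⊕ w =
    trans (degree≡sum-incidence (G ⊕ H) w) (sum-tabulate-+ (edgeCount G) (incidence (G ⊕ H) w))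

  degree-⊕-↑ˡ : ∀ v → degree (G ⊕ H) (v ↑ˡ n) ≡ degree G v
  degree-⊕-↑ˡ v = begin
    degree (G ⊕ H) (v ↑ˡ n)
      ≡⟨ degree-⊕ (v ↑ˡ n) ⟩
    sum (tabulate (λ e → incidence (G ⊕ H) (v ↑ˡ n) (e ↑ˡ edgeCount H)))
      + sum (tabulate (λ e → incidence (G ⊕ H) (v ↑ˡ n) (edgeCount G ↑ʳ e)))
      ≡⟨ cong₂ _+_
           (cong sum (tabulate-cong λ e →
              incidence-map {G = G} {H = G ⊕ H} (_↑ˡ n) (ends-⊕-↑ˡ e) (Fin.↑ˡ-injective n _ _) v))
           (sum-tabulate-zero λ e →
              incidence-outside-image {G = H} {H = G ⊕ H} (m ↑ʳ_) (ends-⊕-↑ʳ e)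
                                      (λ x → ↑ˡ≢↑ʳ v x ∘ sym)) ⟩
    sum (tabulate (incidence G v)) + 0
      ≡⟨ +-identityʳ _ ⟩
    sum (tabulate (incidence G v))
      ≡⟨ degree≡sum-incidence G v ⟨
    degree G v ∎

  degree-⊕-↑ʳ : ∀ v → degree (G ⊕ H) (m ↑ʳ v) ≡ degree H v
  degree-⊕-↑ʳ v = begin
    degree (G ⊕ H) (m ↑ʳ v)
      ≡⟨ degree-⊕ (m ↑ʳ v) ⟩
    sum (tabulate (λ e → incidence (G ⊕ H) (m ↑ʳ v) (e ↑ˡ edgeCount H)))
      + sum (tabulate (λ e → incidence (G ⊕ H) (m ↑ʳ v) (edgeCount G ↑ʳ e)))
      ≡⟨ cong₂ _+_
           (sum-tabulate-zero λ e →
              incidence-outside-image {G = G} {H = G ⊕ H} (_↑ˡ n) (ends-⊕-↑ˡ e) (λ x → ↑ˡ≢↑ʳ x v))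
           (cong sum (tabulate-cong λ e →
              incidence-map {G = H} {H = G ⊕ H} (m ↑ʳ_) (ends-⊕-↑ʳ e) (Fin.↑ʳ-injective m _ _) v)) ⟩
    0 + sum (tabulate (incidence H v))
      ≡⟨ degree≡sum-incidence H v ⟨
    degree H v ∎

  ⊕-regular : ∀ {d} → (∀ v → degree G v ≡ d) → (∀ v → degree H v ≡ d) → ∀ w → degree (G ⊕ H) w ≡ d
  ⊕-regular G-regular H-regular = ↑ˡ-↑ʳ-elim
    (λ v → trans (degree-⊕-↑ˡ v) (G-regular v))
    (λ v → trans (degree-⊕-↑ʳ v) (H-regular v))

-- Copies of K₄

K₄ : Multigraph 4
K₄ = record
  { edgeCount = 6
  ; ends = λ { 0F → 0F , 1F ; 1F → 0F , 2F ; 2F → 0F , 3F ; 3F → 1F , 2F ; 4F → 1F , 3F ; 5F → 2F , 3F }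
  }

K₄-cubic : ∀ v → degree K₄ v ≡ 3
K₄-cubic 0F = refl
K₄-cubic 1F = refl
K₄-cubic 2F = refl
K₄-cubic 3F = refl

K₄-triangular : Triangular K₄
K₄-triangular = toWitness {a? = triangular? K₄} _

copies-of-K₄ : ∀ q → IsDegreeSequenceOf {q * 4} Triangular (λ _ → 3)
copies-of-K₄ zero = record { edgeCount = 0 ; ends = λ () } , (λ ()) , (λ ())
copies-of-K₄ (suc q) with G , G-triangular , G-cubic ← copies-of-K₄ q =
  K₄ ⊕ G , ⊕-triangular K₄ G K₄-triangular G-triangular , ⊕-regular K₄ G K₄-cubic G-cubic

4∣n⇒cubic-triangular : ∀ {n} → 4 ∣ n → IsDegreeSequenceOf {n} Triangular (λ _ → 3)
4∣n⇒cubic-triangular (divides q refl) = copies-of-K₄ q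

proposition1p6 : (n : ℕ) → 1 ≤ n →
    (IsDegreeSequenceOf {n} Triangular (λ _ → 3) ⇔ 4 ∣ n)
proposition1p6 n _ = mk⇔
  (λ (G , G-triangular , G-cubic) → CubicTriangular.4∣n G G-triangular G-cubic)
  4∣n⇒cubic-triangular
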